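{- Let $L$ be an $\Omega^{*}$-compact dcpo. Then $L$ is a dominated dcpo.
   Context: A dcpo is a poset in which every directed subset has a supremum. The Scott topology on $L$: closed sets are lower sets closed under suprema of directed subsets. $IRR(L)$ is the set of nonempty Scott closed sets $C$ that are irreducible ($C\subseteq A\cup B$ with $A,B$ Scott closed implies $C\subseteq A$ or $C\subseteq B$), ordered by inclusion. For $A,B\in IRR(L)$ write $A\lhd B$ if there is $b\in B$ with $A\subseteq\downarrow b$, and $\nabla B=\{A\in IRR(L):A\lhd B\}$. $L$ is dominated if for every $A\in IRR(L)$, $\nabla A$ is Scott closed in the poset $IRR(L)$. The lower topology $\omega(L)$ has the principal filters $\uparrow a$ ($a\in L$) as subbasic closed sets. $L$ is $\Omega^*$-compact if every Scott closed subset of $L$ is compact in the lower topology $\omega(L)$ (i.e. the $T_0$ space $L$ with its Scott topology, whose specialization order is the order of $L$, has every closed set compact in the lower topology of its specialization order). -}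

module Defs where

open import Level using (Level; _⊔_; 0ℓ) renaming (suc to lsuc)
open import Data.Product using (Σ; ∃; _×_; _,_; proj₁; proj₂)
open import Data.Sum using (_⊎_)
open import Data.List using (List)
open import Data.List.Relation.Unary.All using (All)
open import Data.List.Relation.Unary.Any using (Any)
open import Relation.Nullary using (¬_)
open import Relation.Unary using (Pred; _∈_; _⊆_; _∪_)
open import Relation.Binary using (IsPartialOrder)
open import Relation.Binary.PropositionalEquality using (_≡_)

module Order {a r : Level} {A : Set a} (_≤_ : A → A → Set r) where

  ↓ : A → Pred A r
  ↓ b x = x ≤ b

  ↑ : A → Pred A r
  ↑ b x = b ≤ x

  Directed : {p : Level} → Pred A p → Set (a ⊔ r ⊔ p)
  Directed D = (∃ λ x → x ∈ D)
             × (∀ {x y} → x ∈ D → y ∈ D → ∃ λ z → z ∈ D × x ≤ z × y ≤ z)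

  UpperBound : {p : Level} → Pred A p → A → Set (a ⊔ r ⊔ p)
  UpperBound D s = ∀ {x} → x ∈ D → x ≤ s

  IsSup : {p : Level} → Pred A p → A → Set (a ⊔ r ⊔ p)
  IsSup D s = UpperBound D s × (∀ u → UpperBound D u → s ≤ u)

  LowerSet : {q : Level} → Pred A q → Set (a ⊔ r ⊔ q)
  LowerSet C = ∀ {x y} → x ≤ y → y ∈ C → x ∈ C

  ScottClosed : (p : Level) {q : Level} → Pred A q → Set (a ⊔ r ⊔ lsuc p ⊔ q)
  ScottClosed p C = LowerSet C
    × (∀ (D : Pred A p) s → Directed D → D ⊆ C → IsSup D s → s ∈ C)

IsDcpo : (L : Set) (_≤_ : L → L → Set) → Set₁
IsDcpo L _≤_ = IsPartialOrder _≡_ _≤_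
  × (∀ (D : Pred L 0ℓ) → Directed D → ∃ λ s → IsSup D s)
  where open Order _≤_

module OnL (L : Set) (_≤_ : L → L → Set) where
  open Order _≤_ public

  SC : Pred L 0ℓ → Set₁
  SC = ScottClosed 0ℓ

  Irreducible : Pred L 0ℓ → Set₁
  Irreducible C = (∃ λ x → x ∈ C) × SC C
    × (∀ (A B : Pred L 0ℓ) → SC A → SC B → C ⊆ (A ∪ B) → (C ⊆ A) ⊎ (C ⊆ B))

  IRR : Set₁
  IRR = Σ (Pred L 0ℓ) Irreducible

  _⊑_ : IRR → IRR → Set
  X ⊑ Y = proj₁ X ⊆ proj₁ Y

  _◁_ : IRR → IRR → Set
  X ◁ Y = ∃ λ b → b ∈ proj₁ Y × proj₁ X ⊆ ↓ b

  ∇ : IRR → Pred IRR 0ℓ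
  ∇ Y X = X ◁ Y

  -- dominated: ∇ A is Scott closed in the poset IRR(L) for every A
  -- (directed subsets of IRR(L) are predicates of level 1, the level of IRR itself)
  Dominated : Set₂
  Dominated = ∀ (A : IRR) → Order.ScottClosed _⊑_ (lsuc 0ℓ) (∇ A)

  -- lower topology ω(L): subbasic closed sets ↑ a; basic open sets are
  -- finite intersections of the complements L ∖ ↑ a
  BasicOpen : List L → Pred L 0ℓ
  BasicOpen as x = All (λ a → ¬ (a ≤ x)) as

  LowerOpen : Pred L 0ℓ → Set
  LowerOpen U = ∀ {x} → x ∈ U → ∃ λ as → x ∈ BasicOpen as × BasicOpen as ⊆ U

  LowerCompact : Pred L 0ℓ → Set₁
  LowerCompact C = ∀ (I : Set) (U : I → Pred L 0ℓ) → (∀ i → LowerOpen (U i))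
    → C ⊆ (λ x → ∃ λ i → x ∈ U i)
    → ∃ λ (is : List I) → C ⊆ (λ x → Any (λ i → x ∈ U i) is)

  OmegaStarCompact : Set₁
  OmegaStarCompact = ∀ (C : Pred L 0ℓ) → SC C → LowerCompact C

-- Let 𝒟 be a directed family in ∇ A with supremum S. If some b ∈ A bounds
-- every member of 𝒟, then ↓ b is an irreducible upper bound of 𝒟, so
-- S ⊆ ↓ b and S ◁ A. Otherwise the lower-open sets L ∖ ↑ x, x ∈ ⋃ 𝒟, cover
-- A; since A is Scott closed it is lower compact, so finitely many x₁ … xₙ
-- suffice. By directedness they all lie in one Z ∈ 𝒟, and Z ◁ A gives
-- b ∈ A above all xᵢ, so b lies in none of the L ∖ ↑ xᵢ: a contradiction.
module Submission where

open import Defs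
open import Level using (0ℓ; lift; lower) renaming (suc to lsuc)
open import Axiom.ExcludedMiddle using (ExcludedMiddle)
open import Axiom.DoubleNegationElimination using (em⇒dne)
open import Data.Product using (Σ; ∃; _×_; _,_; proj₁; proj₂)
open import Data.Sum using (_⊎_; inj₁; inj₂)
open import Data.Empty using (⊥-elim)
open import Data.List using (List; []; _∷_; map)
open import Data.List.Relation.Unary.All as All using (All; []; _∷_)
open import Data.List.Relation.Unary.All.Properties using (map⁺; map⁻; Any¬⇒¬All)
open import Relation.Nullary using (¬_; yes; no)
open import Relation.Nullary.Decidable using (True; toWitness; fromWitness; map′)
open import Relation.Unary using (Pred; _∈_; _⊆_; ∁)
open import Relation.Binary using (IsPreorder; IsPartialOrder)
open import Relation.Binary.PropositionalEquality using (_≡_)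

module _ {L : Set} {_≤_ : L → L → Set} where
  open OnL L _≤_
  module ⊑ = Order _⊑_

  ↓-irreducible : IsPreorder _≡_ _≤_ → (b : L) → Irreducible (↓ b)
  ↓-irreducible isPreorder b =
    (b , refl) , (trans , sup-below) , prime
    where
    open IsPreorder isPreorder using (refl; trans)

    sup-below : ∀ D s → Directed D → D ⊆ ↓ b → IsSup D s → s ≤ b
    sup-below _ _ _ D⊆↓b (_ , least) = least b D⊆↓b

    prime : ∀ A B → SC A → SC B → ↓ b ⊆ (λ x → A x ⊎ B x) → ↓ b ⊆ A ⊎ ↓ b ⊆ B
    prime A B (A-lower , _) (B-lower , _) ↓b⊆A∪B with ↓b⊆A∪B refl
    ... | inj₁ b∈A = inj₁ (λ x≤b → A-lower x≤b b∈A)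
    ... | inj₂ b∈B = inj₂ (λ x≤b → B-lower x≤b b∈B)

  ↓-IRR : IsPreorder _≡_ _≤_ → L → IRR
  ↓-IRR isPreorder b = ↓ b , ↓-irreducible isPreorder b

  ∁↑-lowerOpen : (a : L) → LowerOpen (∁ (↑ a))
  ∁↑-lowerOpen a a≰x = a ∷ [] , a≰x ∷ [] , All.head

  ⋃ : Pred IRR (lsuc 0ℓ) → Pred L (lsuc 0ℓ)
  ⋃ 𝒟 x = ∃ λ X → X ∈ 𝒟 × x ∈ proj₁ X

  finite-⊆-member : ∀ {𝒟} → ⊑.Directed 𝒟 → (xs : List L) → All (⋃ 𝒟) xs
    → ∃ λ Z → Z ∈ 𝒟 × All (_∈ proj₁ Z) xs
  finite-⊆-member ((X , X∈𝒟) , _) [] [] = X , X∈𝒟 , []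
  finite-⊆-member dir@(_ , upper) (x ∷ xs) ((Y , Y∈𝒟 , x∈Y) ∷ xs⊆⋃)
    with finite-⊆-member dir xs xs⊆⋃
  ... | X , X∈𝒟 , xs⊆X with upper Y∈𝒟 X∈𝒟
  ... | Z , Z∈𝒟 , Y⊑Z , X⊑Z = Z , Z∈𝒟 , Y⊑Z x∈Y ∷ All.map X⊑Z xs⊆X

  ∇-lowerSet : (A : IRR) → ⊑.LowerSet (∇ A)
  ∇-lowerSet A X⊑Y (b , b∈A , Y⊆↓b) = b , b∈A , λ x∈X → Y⊆↓b (X⊑Y x∈X)

  Bounded : Pred L 0ℓ → Pred IRR (lsuc 0ℓ) → Set₁
  Bounded C 𝒟 = ∃ λ b → b ∈ C × ⋃ 𝒟 ⊆ ↓ b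

  Escapes : Pred L 0ℓ → Pred IRR (lsuc 0ℓ) → Set₁
  Escapes C 𝒟 = C ⊆ λ b → ∃ λ x → x ∈ ⋃ 𝒟 × ¬ x ≤ b

  module _ (em : ExcludedMiddle (lsuc 0ℓ)) where

    bounded-or-escapes : ∀ C 𝒟 → Bounded C 𝒟 ⊎ Escapes C 𝒟
    bounded-or-escapes C 𝒟 with em {Bounded C 𝒟}
    ... | yes bounded = inj₁ bounded
    ... | no unbounded = inj₂ escape
      where
      dne : ∀ {P : Set} → ¬ ¬ P → P
      dne = em⇒dne (map′ lower lift em)

      escape : Escapes C 𝒟
      escape {b} b∈C with em {∃ λ x → x ∈ ⋃ 𝒟 × ¬ x ≤ b}
      ... | yes witness = witness
      ... | no none = ⊥-elim (unbounded (b , b∈C , λ {x} x∈⋃ →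
        dne (λ x≰b → none (x , x∈⋃ , x≰b))))

    -- Open covers are indexed by small types, but ⋃ 𝒟 is large; deciding
    -- membership with em turns it into a small index type.
    Index : Pred IRR (lsuc 0ℓ) → Set
    Index 𝒟 = Σ L λ x → True (em {x ∈ ⋃ 𝒟})

    Escapes→Index-cover : ∀ {C 𝒟} → Escapes C 𝒟
      → C ⊆ λ b → ∃ λ (i : Index 𝒟) → b ∈ ∁ (↑ (proj₁ i))
    Escapes→Index-cover escape b∈C with escape b∈C
    ... | x , x∈⋃ , x≰b = (x , fromWitness x∈⋃) , x≰b

    compact-not-escaped : ∀ {C 𝒟} → LowerCompact C → ⊑.Directed 𝒟
      → (∀ {X} → X ∈ 𝒟 → ∃ λ b → b ∈ C × proj₁ X ⊆ ↓ b) → ¬ Escapes C 𝒟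
    compact-not-escaped {𝒟 = 𝒟} compact dir bounded escape
      with compact (Index 𝒟) (λ i → ∁ (↑ (proj₁ i))) (λ i → ∁↑-lowerOpen (proj₁ i))
             (Escapes→Index-cover escape)
    ... | is , subcover
      with finite-⊆-member dir (map proj₁ is)
             (map⁺ (All.universal (λ i → toWitness (proj₂ i)) is))
    ... | Z , Z∈𝒟 , is⊆Z with bounded Z∈𝒟
    ... | b , b∈C , Z⊆↓b = Any¬⇒¬All (subcover b∈C) (All.map Z⊆↓b (map⁻ is⊆Z))

    ∇-scottClosed : IsPreorder _≡_ _≤_ → OmegaStarCompact → (A : IRR)
      → ⊑.ScottClosed (lsuc 0ℓ) (∇ A)
    -- X and Y must be passed explicitly: _⊑_ and ∇ A only mention proj₁ X
    -- and proj₁ Y, so unification cannot recover them.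
    ∇-scottClosed isPreorder omega A@(C , _ , C-scottClosed , _) =
      (λ {X} {Y} → ∇-lowerSet A {X} {Y}) , ∇-closed-under-sup
      where
      ∇-closed-under-sup : ∀ 𝒟 S → ⊑.Directed 𝒟 → 𝒟 ⊆ ∇ A → ⊑.IsSup 𝒟 S → S ∈ ∇ A
      ∇-closed-under-sup 𝒟 S dir 𝒟⊆∇A (_ , least) with bounded-or-escapes C 𝒟
      ... | inj₁ (b , b∈C , ⋃⊆↓b) =
        b , b∈C , least (↓-IRR isPreorder b) (λ X∈𝒟 x∈X → ⋃⊆↓b (_ , X∈𝒟 , x∈X))
      ... | inj₂ escape =
        ⊥-elim (compact-not-escaped (omega C C-scottClosed) dir 𝒟⊆∇A escape)

mainTheorem11 : ExcludedMiddle (lsuc 0ℓ) → (L : Set) (_≤_ : L → L → Set) → IsDcpo L _≤_ → OnL.OmegaStarCompact L _≤_ → OnL.Dominated L _≤_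
mainTheorem11 em L _≤_ (isPartialOrder , _) omega =
  ∇-scottClosed em (IsPartialOrder.isPreorder isPartialOrder) omega
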